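{- For all $k\ge1$ and $n\ge0$, $F_k(n)=\sum_{p\in D_k(n)}A_{k,p\ominus1}$. More generally, for all $1\le q\le k$, $F_k^q(n)=\sum_{p\in D_k(n)}A_{k,p\ominus q}$.
   Context: For $k\ge1$, $F_k:\mathbb{N}\to\mathbb{N}$ is defined by $F_k(0)=0$ and $F_k(n)=n-F_k^k(n-1)$ for $n\ge1$, where $F_k^j$ denotes the $j$-th iterate of $F_k$. The sequence $(A_{k,p})_{p\ge0}$ is defined by $A_{k,p}=p+1$ for $0\le p<k$ and $A_{k,p}=A_{k,p-1}+A_{k,p-k}$ for $p\ge k$. For $a,b\in\mathbb{N}$, $a\ominus b=\max(0,a-b)$. For $n\ge0$, $D_k(n)$ denotes the unique finite set $D\subset\mathbb{N}$ whose elements are pairwise at distance at least $k$ and such that $\sum_{p\in D}A_{k,p}=n$ (its existence and uniqueness is a generalized Zeckendorf theorem). -}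

module Defs where

open import Data.Nat using (ℕ; zero; suc; _+_; _∸_; _≤_; _<ᵇ_; _≤ᵇ_)
open import Data.Bool using (if_then_else_)
open import Data.List using (List; []; _∷_; map)
open import Data.Nat.ListAction using (sum)
open import Data.Product using (_×_)
open import Relation.Binary.PropositionalEquality using (_≡_)
open import Data.List.Relation.Unary.AllPairs using (AllPairs)

iter : (ℕ → ℕ) → ℕ → ℕ → ℕ
iter f zero    x = x
iter f (suc j) x = f (iter f j x)

-- Ftab k n : a function agreeing with F_k on {0,…,n}.
-- Ftab k (suc n) agrees with Ftab k n below n+1, and at n+1 it is
-- (n+1) ∸ F_k^k(n), computed by iterating Ftab k n starting at n.
-- (Since F_k(m) ≤ m, these iterates never leave {0,…,n}.)
Ftab : ℕ → ℕ → ℕ → ℕ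
Ftab k zero    m = 0
Ftab k (suc n) m =
  if m ≤ᵇ n then Ftab k n m else (suc n ∸ iter (Ftab k n) k n)

-- F_k(n), with F_k(0) = 0 and F_k(n) = n - F_k^k(n-1)
F : ℕ → ℕ → ℕ
F k n = Ftab k n n

-- A_{k,p}: p+1 for p < k, A_{k,p-1} + A_{k,p-k} for p ≥ k.
-- Computed with a fuel argument (fuel ≥ p is an invariant, and
-- fuel = p suffices since both recursive arguments are < p when k ≥ 1).
Aaux : ℕ → ℕ → ℕ → ℕ
Aaux k fuel p with p <ᵇ k
... | Data.Bool.true = suc p
Aaux k zero       p | Data.Bool.false = 0
Aaux k (suc fuel) p | Data.Bool.false =
  Aaux k fuel (p ∸ 1) + Aaux k fuel (p ∸ k)

A : ℕ → ℕ → ℕ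
A k p = Aaux k p p

-- a ⊖ b = max(0, a - b) is truncated subtraction ∸ on ℕ.

-- A finite set D ⊂ ℕ whose elements are pairwise at distance ≥ k,
-- represented as its increasing enumeration: consecutive (indeed all
-- earlier/later) elements a, b satisfy a + k ≤ b.
Spread : ℕ → List ℕ → Set
Spread k D = AllPairs (λ a b → a + k ≤ b) D

IsDecomp : ℕ → ℕ → List ℕ → Set
IsDecomp k n D = Spread k D × (sum (map (A k) D) ≡ n)

-- Write n = Σ_{p ∈ D} A_p with D spread, and let p be the least element of D.
-- If p ≥ 1, the identity A_p − 1 = A_{p−1} + A_{p−1−k} + A_{p−1−2k} + … (down to
-- an index below k) gives a spread decomposition of n − 1, so by strong
-- induction F^k(n − 1) = Σ A_{p'⊖k} over that decomposition, and the recurrence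
-- A_{p'} = A_{p'−1} + A_{p'⊖k} turns F(n) = n − F^k(n − 1) into Σ_{p ∈ D} A_{p⊖1}.
-- Iterating, F^{q+1}(n) = F(Σ_{p ∈ D} A_{p⊖q}) is again evaluated by the formula
-- for F, applied to the shifted set {p ⊖ q}; for q < k this set is spread except
-- that its least element may have collapsed to 0, and the formula for F is
-- proved for such sets as well.
module Submission where

open import Defs
open import Data.Nat using (ℕ; zero; suc; _+_; _∸_; _≤_; _<_; _<ᵇ_; _≤ᵇ_; z≤n; s≤s; s≤s⁻¹; _≤?_; _<?_)
open import Data.Nat.Properties
open import Data.Nat.Induction using (<-rec)
open import Data.Nat.ListAction using (sum)
open import Data.Nat.ListAction.Properties using (sum-++)
open import Algebra.Properties.CommutativeSemigroup +-commutativeSemigroup using (interchange)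
open import Data.Bool using (true; false)
open import Data.Empty using (⊥-elim)
open import Data.Sum using (_⊎_; inj₁; inj₂)
open import Data.Product using (_×_; _,_)
open import Data.List using (List; []; _∷_; map; _++_; [_])
open import Data.List.Properties using (map-++)
open import Data.List.Relation.Unary.All as All using (All; []; _∷_)
import Data.List.Relation.Unary.All.Properties as AllP
open import Data.List.Relation.Unary.AllPairs as AllPairs using ([]; _∷_)
import Data.List.Relation.Unary.AllPairs.Properties as AllPairsP
open import Relation.Nullary using (yes; no)
open import Relation.Binary.PropositionalEquality hiding ([_])

iter-≤ : ∀ {f : ℕ → ℕ} → (∀ x → f x ≤ x) → ∀ j x → iter f j x ≤ x
iter-≤ f≤ zero    x = ≤-refl
iter-≤ f≤ (suc j) x = ≤-trans (f≤ _) (iter-≤ f≤ j x)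

iter-cong-≤ : ∀ {f g : ℕ → ℕ} {m} → (∀ {x} → x ≤ m → f x ≡ g x) →
              (∀ x → g x ≤ x) → ∀ j → iter f j m ≡ iter g j m
iter-cong-≤ f≗g g≤ zero = refl
iter-cong-≤ f≗g g≤ (suc j) rewrite iter-cong-≤ f≗g g≤ j = f≗g (iter-≤ g≤ j _)

Ftab-suc-≤ : ∀ k {n m} → m ≤ n → Ftab k (suc n) m ≡ Ftab k n m
Ftab-suc-≤ k {n} {m} m≤n with m ≤ᵇ n | ≤⇒≤ᵇ m≤n
... | true  | _  = refl
... | false | ()

Ftab-agrees : ∀ k {n m} → m ≤ n → Ftab k n m ≡ F k m
Ftab-agrees k {zero} z≤n = refl
Ftab-agrees k {suc n} m≤1+n with m≤n⇒m<n∨m≡n m≤1+n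
... | inj₁ m<1+n = trans (Ftab-suc-≤ k (s≤s⁻¹ m<1+n)) (Ftab-agrees k (s≤s⁻¹ m<1+n))
... | inj₂ refl  = refl

F-unfold : ∀ k m → F k (suc m) ≡ suc m ∸ iter (Ftab k m) k m
F-unfold k m with m <ᵇ m | <ᵇ⇒< m m
... | false | _   = refl
... | true  | m<m = ⊥-elim (n≮n m (m<m _))

F-≤ : ∀ k x → F k x ≤ x
F-≤ k zero    = z≤n
F-≤ k (suc m) rewrite F-unfold k m = m∸n≤m (suc m) (iter (Ftab k m) k m)

F-suc : ∀ k m → F k (suc m) ≡ suc m ∸ iter (F k) k m
F-suc k m = trans (F-unfold k m) (cong (suc m ∸_) (iter-cong-≤ (Ftab-agrees k) (F-≤ k) k))

module _ (k-1 : ℕ) where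

  private
    k : ℕ
    k = suc k-1

  Aaux-fuel-irrelevant : ∀ {f g p} → p ≤ f → p ≤ g → Aaux k f p ≡ Aaux k g p
  Aaux-fuel-irrelevant {f} {g} {p} p≤f p≤g with p <ᵇ k in p≮k
  ... | true = refl
  Aaux-fuel-irrelevant {zero}  {_}     {zero} z≤n _   | false with () ← p≮k
  Aaux-fuel-irrelevant {suc _} {zero}  {zero} _   z≤n | false with () ← p≮k
  Aaux-fuel-irrelevant {suc f} {suc g} {p}    p≤f p≤g | false =
    cong₂ _+_ (Aaux-fuel-irrelevant (pred-mono-≤ p≤f) (pred-mono-≤ p≤g))
              (Aaux-fuel-irrelevant (≤-trans p∸k≤p∸1 (pred-mono-≤ p≤f))
                                    (≤-trans p∸k≤p∸1 (pred-mono-≤ p≤g)))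
    where
    p∸k≤p∸1 : p ∸ k ≤ p ∸ 1
    p∸k≤p∸1 = ∸-monoʳ-≤ p (s≤s z≤n)

  A-fuel : ∀ {f p} → p ≤ f → Aaux k f p ≡ A k p
  A-fuel p≤f = Aaux-fuel-irrelevant p≤f ≤-refl

  A-init : ∀ {p} → p < k → A k p ≡ suc p
  A-init {p} p<k with p <ᵇ k | <⇒<ᵇ p<k
  ... | true | _ = refl

  A-rec : ∀ p → A k (suc p) ≡ A k p + A k (suc p ∸ k)
  A-rec p with suc p <ᵇ k | <ᵇ⇒< (suc p) k
  ... | false | _ = cong (A k p +_) (A-fuel (m∸n≤m p k-1))
  ... | true  | 1+p<k = sym (begin
      A k p + A k (suc p ∸ k) ≡⟨ cong₂ _+_ (A-init (<-trans (n<1+n p) (1+p<k _)))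
                                           (cong (A k) (m≤n⇒m∸n≡0 (<⇒≤ (1+p<k _)))) ⟩
      suc p + 1               ≡⟨ +-comm (suc p) 1 ⟩
      suc (suc p)             ∎)
    where open ≡-Reasoning

  sumA : ℕ → List ℕ → ℕ
  sumA q D = sum (map (λ p → A k (p ∸ q)) D)

  sumA-++ : ∀ q D E → sumA q (D ++ E) ≡ sumA q D + sumA q E
  sumA-++ q D E = trans (cong sum (map-++ _ D E)) (sum-++ (map (λ p → A k (p ∸ q)) D) _)

  sumA-shift : ∀ r q D → sumA r (map (_∸ q) D) ≡ sumA (r + q) D
  sumA-shift r q []      = refl
  sumA-shift r q (p ∷ D) =
    cong₂ _+_ (cong (A k) (trans (∸-+-assoc p q r) (cong (p ∸_) (+-comm q r))))
              (sumA-shift r q D)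

  sumA-split : ∀ D → All (1 ≤_) D → sumA 0 D ≡ sumA 1 D + sumA k D
  sumA-split []          []      = refl
  sumA-split (suc p ∷ D) (_ ∷ D⁺) =
    trans (cong₂ _+_ (A-rec p) (sumA-split D D⁺))
          (interchange (A k p) (A k (suc p ∸ k)) (sumA 1 D) (sumA k D))

  record PredADecomp (t : ℕ) : Set where
    field
      digits   : List ℕ
      spread   : Spread k digits
      digits≤t : All (_≤ t) digits
      suc-sumA : suc (sumA 0 digits) ≡ A k (suc t)
      sumA-k   : sumA k digits ≡ A k (suc t ∸ k)

  predADecomp-small : ∀ {t} → t < k → PredADecomp t
  predADecomp-small {t} t<k = record
    { digits   = [ t ]
    ; spread   = [] ∷ []
    ; digits≤t = ≤-refl ∷ []
    ; suc-sumA = begin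
        suc (A k t + 0)         ≡⟨ cong suc (+-identityʳ _) ⟩
        suc (A k t)             ≡⟨ +-comm 1 _ ⟩
        A k t + A k 0           ≡⟨ cong (λ i → A k t + A k i) (sym 1+t∸k≡0) ⟩
        A k t + A k (suc t ∸ k) ≡⟨ sym (A-rec t) ⟩
        A k (suc t)             ∎
    ; sumA-k = trans (+-identityʳ _)
                     (cong (A k) (trans (m≤n⇒m∸n≡0 (<⇒≤ t<k)) (sym 1+t∸k≡0)))
    }
    where
    open ≡-Reasoning
    1+t∸k≡0 : suc t ∸ k ≡ 0
    1+t∸k≡0 = m≤n⇒m∸n≡0 t<k

  predADecomp-extend : ∀ {s} → PredADecomp s → PredADecomp (k + s)
  predADecomp-extend {s} dec = record
    { digits   = digits ++ [ k + s ]
    ; spread   = AllPairsP.++⁺ spread ([] ∷ [])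
                   (All.map (λ x≤s → ≤-trans (+-monoˡ-≤ k x≤s) (≤-reflexive (+-comm s k)) ∷ [])
                            digits≤t)
    ; digits≤t = AllP.++⁺ (All.map (λ x≤s → ≤-trans x≤s (m≤n+m s k)) digits≤t) (≤-refl ∷ [])
    ; suc-sumA = begin
        suc (sumA 0 (digits ++ [ k + s ]))  ≡⟨ cong suc (sumA-++ 0 digits [ k + s ]) ⟩
        suc (sumA 0 digits) + (A k (k + s) + 0)
                                            ≡⟨ cong₂ _+_ suc-sumA (+-identityʳ _) ⟩
        A k (suc s) + A k (k + s)           ≡⟨ +-comm (A k (suc s)) _ ⟩
        A k (k + s) + A k (suc s)           ≡⟨ cong (λ i → A k (k + s) + A k i) (sym 1+k+s∸k≡1+s) ⟩
        A k (k + s) + A k (suc (k + s) ∸ k) ≡⟨ sym (A-rec (k + s)) ⟩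
        A k (suc (k + s))                   ∎
    ; sumA-k = begin
        sumA k (digits ++ [ k + s ])        ≡⟨ sumA-++ k digits [ k + s ] ⟩
        sumA k digits + (A k (k + s ∸ k) + 0)
                                            ≡⟨ cong₂ _+_ sumA-k (trans (+-identityʳ _) (cong (A k) (m+n∸m≡n k s))) ⟩
        A k (suc s ∸ k) + A k s             ≡⟨ +-comm (A k (suc s ∸ k)) _ ⟩
        A k s + A k (suc s ∸ k)             ≡⟨ sym (A-rec s) ⟩
        A k (suc s)                         ≡⟨ cong (A k) (sym 1+k+s∸k≡1+s) ⟩
        A k (suc (k + s) ∸ k)               ∎
    }
    where
    open ≡-Reasoning
    open PredADecomp dec
    1+k+s∸k≡1+s : suc (k + s) ∸ k ≡ suc s
    1+k+s∸k≡1+s = trans (cong (_∸ k) (sym (+-suc k s))) (m+n∸m≡n k (suc s))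

  predADecomp : ∀ t → PredADecomp t
  predADecomp = <-rec PredADecomp build
    where
    build : ∀ t → (∀ {s} → s < t → PredADecomp s) → PredADecomp t
    build t rec with t <? k
    ... | yes t<k = predADecomp-small t<k
    ... | no  t≮k = subst PredADecomp (m+[n∸m]≡n k≤t)
                          (predADecomp-extend (rec (∸-monoʳ-< (s≤s z≤n) k≤t)))
      where
      k≤t : k ≤ t
      k≤t = ≮⇒≥ t≮k

  -- The shape of {p ⊖ q : p ∈ D} for spread D and q < k.
  WeaklyApart : ℕ → ℕ → Set
  WeaklyApart a b = a + k ≤ b ⊎ (a ≡ 0 × 1 ≤ b)

  WeakSpread : List ℕ → Set
  WeakSpread = AllPairs.AllPairs WeaklyApart

  weaklyApart-positive : ∀ {a b} → WeaklyApart a b → 1 ≤ b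
  weaklyApart-positive {a} (inj₁ a+k≤b) = ≤-trans (s≤s z≤n) (≤-trans (m≤n+m k a) a+k≤b)
  weaklyApart-positive (inj₂ (_ , 1≤b)) = 1≤b

  weaklyApart⇒apart : ∀ {a b} → 1 ≤ a → WeaklyApart a b → a + k ≤ b
  weaklyApart⇒apart _       (inj₁ a+k≤b)   = a+k≤b
  weaklyApart⇒apart (s≤s _) (inj₂ (() , _))

  apart-∸ : ∀ {q a b} → q < k → a + k ≤ b → WeaklyApart (a ∸ q) (b ∸ q)
  apart-∸ {q} {a} {b} q<k a+k≤b with q ≤? a
  ... | yes q≤a = inj₁ (subst (_≤ b ∸ q) (+-∸-comm k q≤a) (∸-monoˡ-≤ q a+k≤b))
  ... | no  q≰a = inj₂ ( m≤n⇒m∸n≡0 (<⇒≤ (≰⇒> q≰a))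
                       , m<n⇒0<n∸m (<-≤-trans q<k (≤-trans (m≤n+m k a) a+k≤b)))

  spread-∸ : ∀ {q D} → q < k → Spread k D → WeakSpread (map (_∸ q) D)
  spread-∸ q<k sp = AllPairsP.map⁺ (AllPairs.map (apart-∸ q<k) sp)

  positive⇒spread : ∀ {D} → All (1 ≤_) D → WeakSpread D → Spread k D
  positive⇒spread []          []          = []
  positive⇒spread (1≤d ∷ D⁺) (apart ∷ ws) =
    All.map (weaklyApart⇒apart 1≤d) apart ∷ positive⇒spread D⁺ ws

  weakSpread-tail : ∀ {d D} → WeakSpread (d ∷ D) → Spread k D × All (1 ≤_) D
  weakSpread-tail (apart ∷ ws) = positive⇒spread D⁺ ws , D⁺
    where D⁺ = All.map weaklyApart-positive apart

  FFormulaAt : ℕ → Set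
  FFormulaAt n = ∀ D → WeakSpread D → sumA 0 D ≡ n → F k n ≡ sumA 1 D

  iterF-formula : ∀ {n D} → (∀ {m} → m ≤ n → FFormulaAt m) → Spread k D → sumA 0 D ≡ n →
                  ∀ {q} → q ≤ k → iter (F k) q n ≡ sumA q D
  iterF-formula formula sp sum≡n {zero}  _   = sym sum≡n
  iterF-formula {n} {D} formula sp sum≡n {suc q} q<k =
    trans (formula (iter-≤ (F-≤ k) q n) (map (_∸ q) D) (spread-∸ q<k sp)
                   (trans (sumA-shift 0 q D) (sym (iterF-formula formula sp sum≡n (<⇒≤ q<k)))))
          (sumA-shift 1 q D)

  F-suc-from-parts : ∀ {m E} a b c e → (∀ {m'} → m' ≤ m → FFormulaAt m') →
                     Spread k E → sumA 0 E ≡ m →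
                     suc m ≡ (a + b) + (c + e) → sumA k E ≡ b + e → F k (suc m) ≡ a + c
  F-suc-from-parts {m} a b c e formula sp sum≡m parts shifted = begin
    F k (suc m)                 ≡⟨ F-suc k m ⟩
    suc m ∸ iter (F k) k m      ≡⟨ cong₂ _∸_ parts (trans (iterF-formula formula sp sum≡m ≤-refl) shifted) ⟩
    (a + b) + (c + e) ∸ (b + e) ≡⟨ cong (_∸ (b + e)) (interchange a b c e) ⟩
    (a + c) + (b + e) ∸ (b + e) ≡⟨ m+n∸n≡m (a + c) (b + e) ⟩
    a + c                       ∎
    where open ≡-Reasoning

  F-formula-step : ∀ n → (∀ {m} → m < n → FFormulaAt m) → FFormulaAt n
  F-formula-step _ _ [] _ refl = refl
  F-formula-step _ formula (zero ∷ rest) ws refl with weakSpread-tail ws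
  ... | sp , rest⁺ = F-suc-from-parts 1 0 (sumA 1 rest) (sumA k rest) (λ le → formula (s≤s le))
                       sp refl (cong suc (sumA-split rest rest⁺)) refl
  F-formula-step n formula (suc d ∷ rest) (apart ∷ ws) sum≡n = begin
    F k n                ≡⟨ cong (F k) (sym 1+m≡n) ⟩
    F k (suc m)          ≡⟨ F-suc-from-parts (A k d) (A k (suc d ∸ k)) (sumA 1 rest) (sumA k rest)
                              (λ le → formula (subst (_ <_) 1+m≡n (s≤s le)))
                              spread refl parts shifted ⟩
    A k d + sumA 1 rest  ∎
    where
    open ≡-Reasoning
    open PredADecomp (predADecomp d) renaming (spread to digits-spread)
    rest⁺ : All (1 ≤_) rest
    rest⁺ = All.map weaklyApart-positive apart
    spread : Spread k (digits ++ rest)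
    spread = AllPairsP.++⁺ digits-spread (positive⇒spread rest⁺ ws)
               (All.map (λ x≤d → All.map (≤-trans (+-monoˡ-≤ k (m≤n⇒m≤1+n x≤d)))
                                         (All.map (weaklyApart⇒apart (s≤s z≤n)) apart))
                        digits≤t)
    m : ℕ
    m = sumA 0 (digits ++ rest)
    1+m≡ : suc m ≡ A k (suc d) + sumA 0 rest
    1+m≡ = trans (cong suc (sumA-++ 0 digits rest)) (cong (_+ sumA 0 rest) suc-sumA)
    1+m≡n : suc m ≡ n
    1+m≡n = trans 1+m≡ sum≡n
    parts : suc m ≡ (A k d + A k (suc d ∸ k)) + (sumA 1 rest + sumA k rest)
    parts = trans 1+m≡ (cong₂ _+_ (A-rec d) (sumA-split rest rest⁺))
    shifted : sumA k (digits ++ rest) ≡ A k (suc d ∸ k) + sumA k rest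
    shifted = trans (sumA-++ k digits rest) (cong (_+ sumA k rest) sumA-k)

  F-formula : ∀ n → FFormulaAt n
  F-formula = <-rec FFormulaAt F-formula-step

theorem4p10 : (k : ℕ) → 1 ≤ k → (q : ℕ) → 1 ≤ q → q ≤ k →
    (n : ℕ) → (D : List ℕ) → IsDecomp k n D →
    iter (F k) q n ≡ sum (map (λ p → A k (p ∸ q)) D)
theorem4p10 (suc k-1) _ q _ q≤k n D (spread , sum≡n) =
  iterF-formula k-1 (λ {m} _ → F-formula k-1 m) spread sum≡n q≤k
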